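{- Let $A$ and $I$ be types, let $B$ be a type family over $A$, and let $t:A\to I$ and $s:\sum_{a:A}B(a)\to I$. Suppose that: - $A$ has decidable equality; - $B(a)$ is $\Pi$-compact for every $a:A$; - $I$ is a set. Then $\mathsf W_{s,t}(i)$ has decidable equality for every $i:I$.
   Context: The ambient theory is intensional Martin-Löf type theory with function extensionality. A type $Y$ is decidable if $Y+\neg Y$ holds. A type has decidable equality if $x=y$ is decidable for all of its elements $x,y$. A set is a type whose identity types are propositions. A type $X$ is $\Pi$-compact if for every type family $Y$ over $X$ with $Y(x)$ decidable for all $x:X$, the type $\prod_{x:X}Y(x)$ is decidable. The indexed $\mathsf W$-type $\mathsf W_{s,t}$ is the inductive type family over $I$ with a single constructor \[\mathsf{indexedsup}:\prod_{a:A}\Big(\prod_{b:B(a)}\mathsf W_{s,t}(s(a,b))\Big)\to\mathsf W_{s,t}(t(a)).\] -}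

{-# OPTIONS --without-K #-}
module Defs where

open import Level using (Level; _⊔_; suc)
open import Data.Product using (Σ; _,_)
open import Relation.Nullary using (Dec)
open import Relation.Binary.PropositionalEquality using (_≡_)

isProp : ∀ {ℓ} → Set ℓ → Set ℓ
isProp X = (x y : X) → x ≡ y

isSet : ∀ {ℓ} → Set ℓ → Set ℓ
isSet X = (x y : X) → isProp (x ≡ y)

HasDecEq : ∀ {ℓ} → Set ℓ → Set ℓ
HasDecEq X = (x y : X) → Dec (x ≡ y)

isΠCompact : ∀ {ℓ} (ℓ' : Level) → Set ℓ → Set (ℓ ⊔ suc ℓ')
isΠCompact ℓ' X = (Y : X → Set ℓ') → ((x : X) → Dec (Y x)) → Dec ((x : X) → Y x)

data W {a b i} {A : Set a} {B : A → Set b} {I : Set i}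
       (s : Σ A B → I) (t : A → I) : I → Set (a ⊔ b ⊔ i) where
  indexedsup : (x : A) → ((y : B x) → W s t (s (x , y))) → W s t (t x)

{-# OPTIONS --without-K #-}
-- Decide equality on the total space Σ I (W s t), since the indices of two trees
-- need not agree definitionally. Two trees with equal root labels a are equal iff
-- their branch functions over B(a) agree pointwise, which is decidable by
-- induction and Π-compactness of B(a). Passing between the total space and a
-- fibre, and between Σ A (branches) and its second component, uses UIP, which
-- holds for I since it is a set and for A by Hedberg's theorem.

module Submission where

open import Defs
open import Level using (_⊔_)
open import Function using (_∘_)
open import Data.Product using (Σ; _,_; proj₁)
open import Data.Product.Properties using (,-injectiveʳ-UIP)
open import Axiom.Extensionality.Propositional using (Extensionality)
open import Axiom.UniquenessOfIdentityProofs using (UIP; module Decidable⇒UIP)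
open import Relation.Nullary using (Dec; yes; no)
import Relation.Nullary.Decidable as Dec
open import Relation.Binary.PropositionalEquality using (_≡_; refl; cong; cong-app)

isSet⇒UIP : ∀ {ℓ} {X : Set ℓ} → isSet X → UIP X
isSet⇒UIP setX p q = setX _ _ p q

isΠCompact⇒Π-≡-dec : ∀ {ℓ ℓ'} {X : Set ℓ} {P : X → Set ℓ'}
  → Extensionality ℓ ℓ' → isΠCompact ℓ' X
  → {f g : (x : X) → P x} → ((x : X) → Dec (f x ≡ g x)) → Dec (f ≡ g)
isΠCompact⇒Π-≡-dec fe compactX {f} {g} f≟g =
  Dec.map′ fe cong-app (compactX (λ x → f x ≡ g x) f≟g)

fibre-≡-dec : ∀ {ℓ ℓ'} {X : Set ℓ} {P : X → Set ℓ'} → UIP X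
  → {x : X} {u v : P x} → Dec (_≡_ {A = Σ X P} (x , u) (x , v)) → Dec (u ≡ v)
fibre-≡-dec uipX = Dec.map′ (,-injectiveʳ-UIP uipX) (cong (_ ,_))

module _ {a b ℓ} {A : Set a} {B : A → Set b} {I : Set ℓ} {t : A → I} {s : Σ A B → I} where

  W-unfold : Σ I (W s t) → Σ A (λ x → (y : B x) → W s t (s (x , y)))
  W-unfold (_ , indexedsup x f) = x , f

  module _ (fe : Extensionality b (a ⊔ b ⊔ ℓ)) (_≟A_ : HasDecEq A)
           (compactB : (x : A) → isΠCompact (a ⊔ b ⊔ ℓ) (B x)) (uipI : UIP I) where

    W-total-≡-dec : ∀ {i j} (w : W s t i) (w' : W s t j)
      → Dec (_≡_ {A = Σ I (W s t)} (i , w) (j , w'))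
    W-total-≡-dec (indexedsup x f) (indexedsup x' f') with x ≟A x'
    ... | no x≢x' = no (x≢x' ∘ cong (proj₁ ∘ W-unfold))
    ... | yes refl =
      Dec.map′ (cong (λ g → t x , indexedsup x g))
               (,-injectiveʳ-UIP (Decidable⇒UIP.≡-irrelevant _≟A_) ∘ cong W-unfold)
               (isΠCompact⇒Π-≡-dec fe (compactB x)
                 (λ y → fibre-≡-dec uipI (W-total-≡-dec (f y) (f' y))))

theorem8p17 : ∀ {a b ℓ} {A : Set a} {B : A → Set b} {I : Set ℓ}
    → Extensionality b (a ⊔ b ⊔ ℓ)
    → (t : A → I) (s : Σ A B → I)
    → HasDecEq A
    → ((x : A) → isΠCompact (a ⊔ b ⊔ ℓ) (B x))
    → isSet I
    → (i : I) → HasDecEq (W s t i)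
theorem8p17 fe t s decA compactB setI i w w' =
  fibre-≡-dec (isSet⇒UIP setI) (W-total-≡-dec fe decA compactB (isSet⇒UIP setI) w w')
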